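{- Assume the reconstruction conjecture is true. Then for all finite undirected graphs $G$ and $H$ with $G\not\cong H$, player $\forall$ has a winning strategy in the Seurat game $\mathbf{G}^3(G,H)$ (the game with $3$ colours).
   Context: Graphs are finite, undirected, without multiple edges (loops allowed); a graph is identified with its vertex set, and an undirected edge $\{u,v\}$ is regarded as edges in both directions. For a vertex $u$ of $G$, $G\setminus\{u\}$ is the induced subgraph on the remaining vertices. Reconstruction conjecture: if $G$ and $H$ are non-isomorphic (undirected) graphs, at least one having at least three vertices, then there is a graph $F$ such that the number of vertices $u$ of $G$ with $G\setminus\{u\}\cong F$ differs from the number of vertices $v$ of $H$ with $H\setminus\{v\}\cong F$. Seurat game $\mathbf{G}^k(G,H)$: two players $\forall$ and $\exists$, a set $\mathbf{Col}$ of $k$ colours. A position is a pair of functions $g:\mathbf{Col}\to\wp(G)$, $h:\mathbf{Col}\to\wp(H)$; initially every colour is assigned the empty set. There are $\omega$ rounds. In each round $\forall$ chooses a colour $c$, one of the two graphs, and a subset of its vertices; then $\exists$ chooses a subset of the vertices of the other graph; the new position agrees with the old one except that $c$ is now assigned the two chosen sets (erasing its previous use). The palette of a vertex is the set of colours whose assigned set contains it; for $P\subseteq\mathbf{Col}$, $P^G$ (resp. $P^H$) is the set of vertices with palette exactly $P$. $\forall$ wins in round $n$ if at the beginning of that round either (C1) some palette $P$ has $P^G$ empty and $P^H$ nonempty or vice versa, or (C2) there are palettes $P_1,P_2$ with an edge from $P_1^G$ to $P_2^G$ but none from $P_1^H$ to $P_2^H$, or vice versa. $\forall$ has a winning strategy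 if he can guarantee a win in finitely many rounds. -}

module Defs where

open import Data.Nat using (ℕ; zero; suc; _≤_)
open import Data.Fin using (Fin; punchIn; _≟_)
open import Data.Bool using (Bool; true; false; if_then_else_)
open import Data.Product using (Σ; ∃; _×_; _,_)
open import Data.Sum using (_⊎_)
open import Relation.Nullary using (¬_; does)
open import Relation.Binary.PropositionalEquality using (_≡_; _≢_)
open import Function.Bundles using (_↔_; _⇔_; Inverse)
open import Function.Definitions using (Injective)

-- Finite undirected graphs (loops allowed, no multiple edges).
-- The vertex set is Fin size; adjacency is a symmetric Bool-valued relation.

record Graph : Set where
  field
    size : ℕ
    adj  : Fin size → Fin size → Bool
    sym  : ∀ x y → adj x y ≡ adj y x

open Graph public

_≅_ : Graph → Graph → Set
G ≅ H = Σ (Fin (size G) ↔ Fin (size H)) λ f →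
          ∀ x y → adj H (Inverse.to f x) (Inverse.to f y) ≡ adj G x y

private
  del : (n : ℕ) (a : Fin n → Fin n → Bool) → (∀ x y → a x y ≡ a y x) → Fin n → Graph
  del (suc m) a s u = record
    { size = m
    ; adj  = λ x y → a (punchIn u x) (punchIn u y)
    ; sym  = λ x y → s (punchIn u x) (punchIn u y)
    }

delete : (G : Graph) → Fin (size G) → Graph
delete G u = del (size G) (adj G) (sym G) u

HasSize : {n : ℕ} → (Fin n → Set) → ℕ → Set
HasSize {n} P k = Σ (Fin k → Fin n) λ f →
  Injective _≡_ _≡_ f × (∀ u → P u ⇔ ∃ λ i → f i ≡ u)

DeckCountsDiffer : Graph → Graph → Graph → Set
DeckCountsDiffer G H F = Σ ℕ λ k → Σ ℕ λ l → k ≢ l ×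
  HasSize (λ u → delete G u ≅ F) k × HasSize (λ v → delete H v ≅ F) l

ReconstructionConjecture : Set
ReconstructionConjecture = ∀ (G H : Graph) → ¬ (G ≅ H) →
  (3 ≤ size G ⊎ 3 ≤ size H) → ∃ λ F → DeckCountsDiffer G H F

module Seurat (k : ℕ) (G H : Graph) where

  Col : Set
  Col = Fin k

  record Position : Set where
    constructor pos
    field
      g : Col → Fin (size G) → Bool
      h : Col → Fin (size H) → Bool
  open Position public

  initial : Position
  initial = pos (λ _ _ → false) (λ _ _ → false)

  assign : {n : ℕ} → (Col → Fin n → Bool) → Col → (Fin n → Bool) → Col → Fin n → Bool
  assign f c S c' = if does (c' ≟ c) then S else f c'

  Palette : Set
  Palette = Col → Bool

  HasPalette : {n : ℕ} → (Col → Fin n → Bool) → Fin n → Palette → Set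
  HasPalette f v P = ∀ c → f c v ≡ P c

  Inhabited : {n : ℕ} → (Col → Fin n → Bool) → Palette → Set
  Inhabited f P = ∃ λ v → HasPalette f v P

  EdgeBetween : (X : Graph) → (Col → Fin (size X) → Bool) → Palette → Palette → Set
  EdgeBetween X f P₁ P₂ = ∃ λ x → ∃ λ y →
    HasPalette f x P₁ × HasPalette f y P₂ × adj X x y ≡ true

  C1 : Position → Set
  C1 p = ∃ λ P → (¬ Inhabited (g p) P × Inhabited (h p) P)
                ⊎ (Inhabited (g p) P × ¬ Inhabited (h p) P)

  C2 : Position → Set
  C2 p = ∃ λ P₁ → ∃ λ P₂ →
      (EdgeBetween G (g p) P₁ P₂ × ¬ EdgeBetween H (h p) P₁ P₂)
    ⊎ (¬ EdgeBetween G (g p) P₁ P₂ × EdgeBetween H (h p) P₁ P₂)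

  ForallWinsNow : Position → Set
  ForallWinsNow p = C1 p ⊎ C2 p

  -- ∀ can force a win in finitely many rounds from position p.
  -- A proof is a well-founded (history-dependent) strategy tree: either the
  -- winning condition holds now, or ∀ has a move (colour c, a graph, a set)
  -- such that after every reply of ∃ he can again force a win.
  data ForallForcesWin (p : Position) : Set where
    now    : ForallWinsNow p → ForallForcesWin p
    playG  : (c : Col) (S : Fin (size G) → Bool) →
             (∀ (T : Fin (size H) → Bool) →
                ForallForcesWin (pos (assign (g p) c S) (assign (h p) c T))) →
             ForallForcesWin p
    playH  : (c : Col) (T : Fin (size H) → Bool) →
             (∀ (S : Fin (size G) → Bool) →
                ForallForcesWin (pos (assign (g p) c S) (assign (h p) c T))) →
             ForallForcesWin p

ForallHasWinningStrategy : ℕ → Graph → Graph → Set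
ForallHasWinningStrategy k G H = Seurat.ForallForcesWin k G H (Seurat.initial k G H)

-- ∀ keeps colour 0 on two regions R ⊆ G and R' ⊆ H whose induced subgraphs are not
-- isomorphic, with colours 1 and 2 unused.  Whatever ∀ colours by a Boolean combination of
-- the colours in G, ∃ must colour by the same combination in H, or some palette is missing
-- on one side (C1); with this, ∀ can delete one vertex from each region, the two deleted
-- vertices agreeing on colour 1.  If |R| ≠ |R'|, deleting vertices empties one region first.
-- If |R| = |R'| ≤ 2, colour 1 splits the regions into singleton palettes, and a pair of
-- vertices on which the forced matching is not an isomorphism gives (C2).  If |R| = |R'| ≥ 3,
-- the reconstruction conjecture yields a card F occurring k ≠ l times in the two decks, and ∀
-- colours by 1 the vertices of R whose card is F.  If ∃'s answer misclassifies some v ∈ R',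
-- deleting v together with its partner u leaves non-isomorphic cards and induction applies;
-- otherwise colour 0 can be moved onto the two sets of sizes k ≠ l.
module Submission where

open import Defs hiding (sym)
open import Data.Bool using (Bool; true; false; not; _∧_)
open import Data.Bool.Properties
  using (⇔→≡; not-¬; ∧-zeroʳ; ∧-identityʳ; ∧-conicalˡ) renaming (_≟_ to _≟ᵇ_)
open import Data.Empty using (⊥-elim)
open import Data.Fin using (Fin; zero; suc; punchIn; punchOut; _≟_)
open import Data.Fin.Permutation using (transpose)
open import Data.Fin.Properties
  using (any?; all?; ¬∀⟶∃¬; ∀-cons; punchIn-injective; punchInᵢ≢i; punchIn-punchOut)
open import Data.Nat using (ℕ; zero; suc; s≤s; z≤n) renaming (_≟_ to _≟ℕ_)
open import Data.Product using (∃; _×_; _,_)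
open import Data.Sum using (inj₁; inj₂)
open import Function using (_∘_; id; case_of_; _↔_; _⇔_; mk⇔; Inverse; Equivalence)
open import Function.Definitions using (Injective)
open import Function.Construct.Composition using (_↔-∘_; injective)
open import Function.Construct.Identity using (↔-id)
open import Function.Construct.Symmetry using (↔-sym)
open import Relation.Nullary using (¬_; yes; no; does)
open import Relation.Nullary.Decidable using (dec-true; dec-false)
open import Relation.Binary.PropositionalEquality
  using (_≡_; _≢_; refl; sym; trans; cong; cong₂; _≗_; module ≡-Reasoning)

private
  variable
    k m n : ℕ

true≢false : true ≢ false
true≢false ()

≗-refl : ∀ {S : Fin n → Bool} → S ≗ S
≗-refl _ = refl

∅ : Fin n → Bool
∅ _ = false

｛_｝ : Fin n → Fin n → Bool
｛ u ｝ x = does (x ≟ u)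

_∩_ : (Fin n → Bool) → (Fin n → Bool) → Fin n → Bool
(S ∩ T) x = S x ∧ T x

_∖_ : (Fin n → Bool) → Fin n → Fin n → Bool
(S ∖ u) x = S x ∧ not (does (x ≟ u))

_⊆_ : (Fin n → Bool) → (Fin n → Bool) → Set
S ⊆ T = ∀ x → S x ≡ true → T x ≡ true

∖-⊆ : ∀ (S : Fin n → Bool) u → (S ∖ u) ⊆ S
∖-⊆ S u x = ∧-conicalˡ (S x) _

∖-removes : ∀ (S : Fin n → Bool) u → (S ∖ u) u ≡ false
∖-removes S u = trans (cong (λ b → S u ∧ not b) (dec-true (u ≟ u) refl)) (∧-zeroʳ (S u))

∖-only : ∀ {S : Fin n → Bool} {u x} → S x ≡ true → (S ∖ u) x ≡ false → x ≡ u
∖-only {S = S} {u} {x} x∈S x∉S∖u with x ≟ u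
... | yes x≡u = x≡u
... | no _ with () ← trans (sym x∈S) (trans (sym (∧-identityʳ (S x))) x∉S∖u)

≗-∖ : ∀ {S T : Fin n → Bool} {u} → S ⊆ T → S u ≡ false →
      (∀ x → T x ≡ true → S x ≡ false → x ≡ u) → S ≗ T ∖ u
≗-∖ {S = S} {T} {u} S⊆T u∉S only-u x with x ≟ u
... | yes refl = trans u∉S (sym (∧-zeroʳ (T x)))
... | no x≢u  = trans (S≡T x≢u) (sym (∧-identityʳ (T x)))
  where
  S≡T : x ≢ u → S x ≡ T x
  S≡T x≢u with S x in x∈S | T x in x∈T
  ... | true  | _     = sym (trans (sym x∈T) (S⊆T x x∈S))
  ... | false | false = refl
  ... | false | true  = ⊥-elim (x≢u (only-u x x∈T x∈S))

｛｝-∘ : ∀ {e : Fin k → Fin n} → Injective _≡_ _≡_ e → ∀ x i → ｛ e x ｝ (e i) ≡ ｛ x ｝ i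
｛｝-∘ {e = e} e-inj x i with i ≟ x
... | yes refl = dec-true (e i ≟ e i) refl
... | no i≢x   = dec-false (e i ≟ e x) (i≢x ∘ e-inj)

｛zero｝-injective : ∀ {i x : Fin 2} → ｛ zero ｝ i ≡ ｛ zero ｝ x → i ≡ x
｛zero｝-injective {zero}     {zero}     _ = refl
｛zero｝-injective {suc zero} {suc zero} _ = refl
｛zero｝-injective {zero}     {suc zero} ()
｛zero｝-injective {suc zero} {zero}     ()

image : (Fin k → Fin n) → Fin n → Bool
image e x = does (any? λ i → e i ≟ x)

∈-image⁺ : ∀ {e : Fin k → Fin n} {x} → ∃ (λ i → e i ≡ x) → image e x ≡ true
∈-image⁺ = dec-true (any? _)

∈-image⁻ : ∀ (e : Fin k → Fin n) {x} → image e x ≡ true → ∃ λ i → e i ≡ x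
∈-image⁻ e {x} x∈e with any? (λ i → e i ≟ x)
... | yes found = found

∈-image : ∀ (e : Fin k → Fin n) i → image e (e i) ≡ true
∈-image e i = ∈-image⁺ (i , refl)

∉-image : ∀ {e : Fin k → Fin n} {x} → (∀ i → e i ≢ x) → image e x ≡ false
∉-image x∉e = dec-false (any? _) λ (i , eᵢ≡x) → x∉e i eᵢ≡x

image-∘ : ∀ {e : Fin m → Fin n} (f : Fin k → Fin m) → Injective _≡_ _≡_ e →
          ∀ j → image (e ∘ f) (e j) ≡ image f j
image-∘ {e = e} f e-inj j = ⇔→≡ (mk⇔ ⇒ ⇐)
  where
  ⇒ : image (e ∘ f) (e j) ≡ true → image f j ≡ true
  ⇒ efj∈ with ∈-image⁻ (e ∘ f) efj∈
  ... | i , efᵢ≡eⱼ = ∈-image⁺ (i , e-inj efᵢ≡eⱼ)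
  ⇐ : image f j ≡ true → image (e ∘ f) (e j) ≡ true
  ⇐ fj∈ with ∈-image⁻ f fj∈
  ... | i , refl = ∈-image (e ∘ f) i

image-∘-↔ : ∀ {e : Fin m → Fin n} (σ : Fin k ↔ Fin m) → image (e ∘ Inverse.to σ) ≗ image e
image-∘-↔ {e = e} σ x = ⇔→≡ (mk⇔ ⇒ ⇐)
  where
  open Inverse σ
  ⇒ : image (e ∘ to) x ≡ true → image e x ≡ true
  ⇒ x∈ with ∈-image⁻ (e ∘ to) x∈
  ... | i , refl = ∈-image e (to i)
  ⇐ : image e x ≡ true → image (e ∘ to) x ≡ true
  ⇐ x∈ with ∈-image⁻ e x∈
  ... | j , refl = ∈-image⁺ (from j , cong e (strictlyInverseˡ j))

image-∩ : ∀ {e : Fin m → Fin n} {Y : Fin n → Bool} (f : Fin k → Fin m) →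
          Injective _≡_ _≡_ e → (∀ j → Y (e j) ≡ image f j) → image (e ∘ f) ≗ image e ∩ Y
image-∩ {e = e} {Y} f e-inj Y∘e≗f x with image e x in x∈e
... | false = ∉-image λ i efᵢ≡x →
  true≢false (trans (sym (∈-image e (f i))) (trans (cong (image e) efᵢ≡x) x∈e))
... | true with ∈-image⁻ e x∈e
...   | j , refl = trans (image-∘ f e-inj j) (sym (Y∘e≗f j))

image-∖ : ∀ {e : Fin (suc k) → Fin n} → Injective _≡_ _≡_ e →
          ∀ i → image (e ∘ punchIn i) ≗ image e ∖ e i
image-∖ {e = e} e-inj i x = ⇔→≡ (mk⇔ ⇒ ⇐)
  where
  ⇒ : image (e ∘ punchIn i) x ≡ true → (image e ∖ e i) x ≡ true
  ⇒ x∈ with ∈-image⁻ (e ∘ punchIn i) x∈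
  ... | j , refl = cong₂ _∧_ (∈-image e (punchIn i j))
                     (cong not (dec-false (e (punchIn i j) ≟ e i) (punchInᵢ≢i i j ∘ e-inj)))
  ⇐ : (image e ∖ e i) x ≡ true → image (e ∘ punchIn i) x ≡ true
  ⇐ x∈ with ∈-image⁻ e (∖-⊆ (image e) (e i) x x∈)
  ... | j , refl with i ≟ j
  ...   | yes refl with () ← trans (sym x∈) (∖-removes (image e) (e i))
  ...   | no i≢j = ∈-image⁺ (punchOut i≢j , cong e (punchIn-punchOut i≢j))

∘-punchIn-injective : ∀ {e : Fin (suc k) → Fin n} → Injective _≡_ _≡_ e →
                      ∀ i → Injective _≡_ _≡_ (e ∘ punchIn i)
∘-punchIn-injective e-inj i = punchIn-injective i _ _ ∘ e-inj

induced : (G : Graph) → (Fin n → Fin (size G)) → Graph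
induced {n} G e = record
  { size = n
  ; adj  = λ x y → adj G (e x) (e y)
  ; sym  = λ x y → Graph.sym G (e x) (e y)
  }

≅-sym : ∀ {G H} → G ≅ H → H ≅ G
≅-sym {G} {H} (f , f-adj) = ↔-sym f , λ x y →
  trans (sym (f-adj (from x) (from y))) (cong₂ (adj H) (strictlyInverseˡ x) (strictlyInverseˡ y))
  where open Inverse f

≅-trans : ∀ {F G H} → F ≅ G → G ≅ H → F ≅ H
≅-trans (f , f-adj) (g , g-adj) = g ↔-∘ f , λ x y → trans (g-adj _ _) (f-adj x y)

induced-reindex : ∀ (G : Graph) {e : Fin n → Fin (size G)} (σ : Fin n ↔ Fin n) →
                  induced G (e ∘ Inverse.to σ) ≅ induced G e
induced-reindex G σ = σ , λ _ _ → refl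

induced-adj-mismatch : ∀ {G H : Graph} {e : Fin n → Fin (size G)} {e' : Fin n → Fin (size H)} →
  ¬ (induced G e ≅ induced H e') → ∃ λ x → ∃ λ y → adj G (e x) (e y) ≢ adj H (e' x) (e' y)
induced-adj-mismatch {n} {G} {H} {e} {e'} G≇H
  with all? (λ x → all? (λ y → adj H (e' x) (e' y) ≟ᵇ adj G (e x) (e y)))
... | yes agree = ⊥-elim (G≇H (↔-id _ , agree))
... | no ¬agree with ¬∀⟶∃¬ n _ (λ x → all? λ y → adj H (e' x) (e' y) ≟ᵇ adj G (e x) (e y)) ¬agree
...   | x , ¬agreeₓ with ¬∀⟶∃¬ n _ (λ y → adj H (e' x) (e' y) ≟ᵇ adj G (e x) (e y)) ¬agreeₓ
...     | y , ≢ = x , y , ≢ ∘ sym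

iso-cards-agree : ∀ {K L F : Graph} {fK : Fin k → Fin (size K)} {fL : Fin m → Fin (size L)} →
  (∀ u → (delete K u ≅ F) ⇔ ∃ λ i → fK i ≡ u) → (∀ v → (delete L v ≅ F) ⇔ ∃ λ i → fL i ≡ v) →
  ∀ {u v} → delete K u ≅ delete L v → image fK u ≡ image fL v
iso-cards-agree {K = K} {L} {F} {fK} {fL} K-deck L-deck {u} {v} φ = ⇔→≡ (mk⇔ ⇒ ⇐)
  where
  open Equivalence
  ⇒ : image fK u ≡ true → image fL v ≡ true
  ⇒ u∈ = ∈-image⁺ (to (L-deck v) (≅-trans {delete L v} {delete K u} {F}
           (≅-sym {delete K u} {delete L v} φ) (from (K-deck u) (∈-image⁻ fK u∈))))
  ⇐ : image fL v ≡ true → image fK u ≡ true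
  ⇐ v∈ = ∈-image⁺ (to (K-deck u) (≅-trans {delete K u} {delete L v} {F}
           φ (from (L-deck v) (∈-image⁻ fL v∈))))

c₀ c₁ c₂ : Fin 3
c₀ = zero
c₁ = suc zero
c₂ = suc (suc zero)

_≋_ : (Fin 3 → Fin n → Bool) → (Fin 3 → Fin n → Bool) → Set
f ≋ f' = ∀ c → f c ≗ f' c

≋-sym : ∀ {f f' : Fin 3 → Fin n → Bool} → f ≋ f' → f' ≋ f
≋-sym f≋f' c x = sym (f≋f' c x)

by-colour : ∀ {f f' : Fin 3 → Fin n → Bool} → f c₀ ≗ f' c₀ → f c₁ ≗ f' c₁ → f c₂ ≗ f' c₂ → f ≋ f'
by-colour e₀ e₁ e₂ zero             = e₀
by-colour e₀ e₁ e₂ (suc zero)       = e₁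
by-colour e₀ e₁ e₂ (suc (suc zero)) = e₂

colouring : (Fin n → Bool) → (Fin n → Bool) → (Fin n → Bool) → Fin 3 → Fin n → Bool
colouring S₀ S₁ S₂ zero             = S₀
colouring S₀ S₁ S₂ (suc zero)       = S₁
colouring S₀ S₁ S₂ (suc (suc zero)) = S₂

subst₃ : ∀ {A : Set} (P : A → A → A → Set) {x y z x' y' z'} →
         x ≡ x' → y ≡ y' → z ≡ z' → P x y z → P x' y' z'
subst₃ P refl refl refl p = p

assume-each : ∀ {P : Fin n → Set} {R : Set} → (∀ i → (P i → R) → R) → ((∀ i → P i) → R) → R
assume-each {zero}  step k = k λ ()
assume-each {suc n} step k = step zero λ p₀ → assume-each (step ∘ suc) (k ∘ ∀-cons p₀)

module Game (G H : Graph) where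
  open Seurat 3 G H public

  palette : (Col → Fin n → Bool) → Fin n → Palette
  palette f x c = f c x

  _≈_ : Position → Position → Set
  p ≈ q = g p ≋ g q × h p ≋ h q

  private
    hasPalette-resp : ∀ {f f' : Col → Fin n → Bool} → f ≋ f' →
                      ∀ {v P} → HasPalette f v P → HasPalette f' v P
    hasPalette-resp f≋f' v∈P c = trans (sym (f≋f' c _)) (v∈P c)

    inhabited-resp : ∀ {f f' : Col → Fin n → Bool} → f ≋ f' →
                     ∀ {P} → Inhabited f P → Inhabited f' P
    inhabited-resp f≋f' (v , v∈P) = v , hasPalette-resp f≋f' v∈P

    edgeBetween-resp : ∀ X {f f' : Col → Fin (size X) → Bool} → f ≋ f' →
                       ∀ {P₁ P₂} → EdgeBetween X f P₁ P₂ → EdgeBetween X f' P₁ P₂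
    edgeBetween-resp X f≋f' (x , y , x∈P₁ , y∈P₂ , xy) =
      x , y , hasPalette-resp f≋f' x∈P₁ , hasPalette-resp f≋f' y∈P₂ , xy

    assign-resp : ∀ {f f' : Col → Fin n → Bool} → f ≋ f' → ∀ c S → assign f c S ≋ assign f' c S
    assign-resp f≋f' c S c' with does (c' ≟ c)
    ... | true  = ≗-refl
    ... | false = f≋f' c'

  winsNow-resp : ∀ {p q} → p ≈ q → ForallWinsNow p → ForallWinsNow q
  winsNow-resp (g≋ , h≋) (inj₁ (P , inj₁ (∉G , ∈H))) =
    inj₁ (P , inj₁ (∉G ∘ inhabited-resp (≋-sym g≋) , inhabited-resp h≋ ∈H))
  winsNow-resp (g≋ , h≋) (inj₁ (P , inj₂ (∈G , ∉H))) =
    inj₁ (P , inj₂ (inhabited-resp g≋ ∈G , ∉H ∘ inhabited-resp (≋-sym h≋)))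
  winsNow-resp (g≋ , h≋) (inj₂ (P₁ , P₂ , inj₁ (∈G , ∉H))) =
    inj₂ (P₁ , P₂ , inj₁ (edgeBetween-resp G g≋ ∈G , ∉H ∘ edgeBetween-resp H (≋-sym h≋)))
  winsNow-resp (g≋ , h≋) (inj₂ (P₁ , P₂ , inj₂ (∉G , ∈H))) =
    inj₂ (P₁ , P₂ , inj₂ (∉G ∘ edgeBetween-resp G (≋-sym g≋) , edgeBetween-resp H h≋ ∈H))

  forcesWin-resp : ∀ {p q} → p ≈ q → ForallForcesWin p → ForallForcesWin q
  forcesWin-resp p≈q (now w) = now (winsNow-resp p≈q w)
  forcesWin-resp (g≋ , h≋) (playG c S k) =
    playG c S λ T → forcesWin-resp (assign-resp g≋ c S , assign-resp h≋ c T) (k T)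
  forcesWin-resp (g≋ , h≋) (playH c T k) =
    playH c T λ S → forcesWin-resp (assign-resp g≋ c S , assign-resp h≋ c T) (k S)

  private module Swapped = Seurat 3 H G

  swap : Swapped.Position → Position
  swap p = pos (Swapped.h p) (Swapped.g p)

  winsNow-swap : ∀ {p} → Swapped.ForallWinsNow p → ForallWinsNow (swap p)
  winsNow-swap (inj₁ (P , inj₁ (∉H , ∈G)))       = inj₁ (P , inj₂ (∈G , ∉H))
  winsNow-swap (inj₁ (P , inj₂ (∈H , ∉G)))       = inj₁ (P , inj₁ (∉G , ∈H))
  winsNow-swap (inj₂ (P₁ , P₂ , inj₁ (∈H , ∉G))) = inj₂ (P₁ , P₂ , inj₂ (∉G , ∈H))
  winsNow-swap (inj₂ (P₁ , P₂ , inj₂ (∉H , ∈G))) = inj₂ (P₁ , P₂ , inj₁ (∈G , ∉H))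

  forcesWin-swap : ∀ {p} → Swapped.ForallForcesWin p → ForallForcesWin (swap p)
  forcesWin-swap (Swapped.now w)       = now (winsNow-swap w)
  forcesWin-swap (Swapped.playG c T k) = playH c T λ S → forcesWin-swap (k S)
  forcesWin-swap (Swapped.playH c S k) = playG c S λ T → forcesWin-swap (k T)

  realisedInᴳ : ∀ {p} v → (∀ u → (∀ c → g p c u ≡ h p c v) → ForallForcesWin p) →
                ForallForcesWin p
  realisedInᴳ {p} v k with any? (λ u → all? (λ c → g p c u ≟ᵇ h p c v))
  ... | yes (u , u∼v) = k u u∼v
  ... | no none       = now (inj₁ (palette (h p) v , inj₁ (none , (v , λ _ → refl))))

  realisedInᴴ : ∀ {p} u → (∀ v → (∀ c → h p c v ≡ g p c u) → ForallForcesWin p) →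
                ForallForcesWin p
  realisedInᴴ {p} u k with any? (λ v → all? (λ c → h p c v ≟ᵇ g p c u))
  ... | yes (v , v∼u) = k v v∼u
  ... | no none       = now (inj₁ (palette (g p) u , inj₂ ((u , λ _ → refl) , none)))

  -- A test Π of the three colour bits holding at every vertex of G holds at every vertex of H:
  -- a violating vertex of H has a palette not realised in G.
  assumeᴴ : ∀ {p} (Π : Bool → Bool → Bool → Set) →
    (∀ u → Π (g p c₀ u) (g p c₁ u) (g p c₂ u)) →
    ((∀ v → Π (h p c₀ v) (h p c₁ v) (h p c₂ v)) → ForallForcesWin p) → ForallForcesWin p
  assumeᴴ Π Π-G = assume-each λ v k →
    realisedInᴳ v λ u u∼v → k (subst₃ Π (u∼v c₀) (u∼v c₁) (u∼v c₂) (Π-G u))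

  ⟪_,_,_∣_,_,_⟫ : (A₀ A₁ A₂ : Fin (size G) → Bool) (B₀ B₁ B₂ : Fin (size H) → Bool) → Position
  ⟪ A₀ , A₁ , A₂ ∣ B₀ , B₁ , B₂ ⟫ = pos (colouring A₀ A₁ A₂) (colouring B₀ B₁ B₂)

  marked : (Fin (size G) → Bool) → (Fin (size H) → Bool) → Position
  marked R R' = ⟪ R , ∅ , ∅ ∣ R' , ∅ , ∅ ⟫

  marked-resp : ∀ {R S R' S'} → R ≗ S → R' ≗ S' →
                ForallForcesWin (marked R R') → ForallForcesWin (marked S S')
  marked-resp R≗S R'≗S' =
    forcesWin-resp (by-colour R≗S ≗-refl ≗-refl , by-colour R'≗S' ≗-refl ≗-refl)

  play₁ : ∀ {A₀ A₁ A₂ B₀ B₁ B₂} (S : Fin (size G) → Bool) →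
    (∀ T → ForallForcesWin ⟪ A₀ , S , A₂ ∣ B₀ , T , B₂ ⟫) →
    ForallForcesWin ⟪ A₀ , A₁ , A₂ ∣ B₀ , B₁ , B₂ ⟫
  play₁ S k = playG c₁ S λ T → forcesWin-resp
    (by-colour ≗-refl ≗-refl ≗-refl , by-colour ≗-refl ≗-refl ≗-refl) (k T)

  record Twins (p : Position) (x : Fin (size G)) (x' : Fin (size H)) : Set where
    field
      same  : ∀ c → h p c x' ≡ g p c x
      soleᴳ : ∀ w → (∀ c → g p c w ≡ g p c x) → w ≡ x
      soleᴴ : ∀ w → (∀ c → h p c w ≡ g p c x) → w ≡ x'
  open Twins

  sole-edge : ∀ X {f : Col → Fin (size X) → Bool} {P₁ P₂ x y} →
    (∀ w → HasPalette f w P₁ → w ≡ x) → (∀ w → HasPalette f w P₂ → w ≡ y) →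
    EdgeBetween X f P₁ P₂ → adj X x y ≡ true
  sole-edge X sole₁ sole₂ (a , b , a∈P₁ , b∈P₂ , ab) with sole₁ a a∈P₁ | sole₂ b b∈P₂
  ... | refl | refl = ab

  twins-adj-mismatch : ∀ {p x x' y y'} → Twins p x x' → Twins p y y' →
    adj G x y ≢ adj H x' y' → ForallWinsNow p
  twins-adj-mismatch {p} {x} {x'} {y} {y'} tx ty xy≢x'y' with adj G x y in xy | adj H x' y' in x'y'
  ... | true  | true  = ⊥-elim (xy≢x'y' refl)
  ... | false | false = ⊥-elim (xy≢x'y' refl)
  ... | true  | false = inj₂ (palette (g p) x , palette (g p) y , inj₁
          ( (x , y , (λ _ → refl) , (λ _ → refl) , xy)
          , λ e → true≢false (trans (sym (sole-edge H (soleᴴ tx) (soleᴴ ty) e)) x'y')))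
  ... | false | true  = inj₂ (palette (g p) x , palette (g p) y , inj₂
          ( (λ e → true≢false (trans (sym (sole-edge G (soleᴳ tx) (soleᴳ ty) e)) xy))
          , (x' , y' , same tx , same ty , x'y')))

  wins-on-twinned : ∀ {p} (eG : Fin n → Fin (size G)) (eH : Fin n → Fin (size H)) →
    (∀ x → Twins p (eG x) (eH x)) → ¬ (induced G eG ≅ induced H eH) → ForallForcesWin p
  wins-on-twinned eG eH twins G≇H with induced-adj-mismatch {G = G} {H} {eG} {eH} G≇H
  ... | x , y , xy≢ = now (twins-adj-mismatch (twins x) (twins y) xy≢)

  twins-separated-by-c₁ : ∀ {p} (eG : Fin n → Fin (size G)) (eH : Fin n → Fin (size H)) →
    g p c₀ ≗ image eG → h p c₀ ≗ image eH → (∀ x c → h p c (eH x) ≡ g p c (eG x)) →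
    (∀ i x → g p c₁ (eG i) ≡ g p c₁ (eG x) → i ≡ x) → ∀ x → Twins p (eG x) (eH x)
  twins-separated-by-c₁ {p = p} eG eH g₀≗ h₀≗ eH∼eG separates x = record
    { same  = eH∼eG x
    ; soleᴳ = λ w w∼x → soleᴳ′ w (trans (sym (g₀≗ w)) (w∼x c₀)) (w∼x c₁)
    ; soleᴴ = λ w w∼x → soleᴴ′ w (trans (sym (h₀≗ w)) (w∼x c₀)) (w∼x c₁)
    }
    where
    x∈ : g p c₀ (eG x) ≡ true
    x∈ = trans (g₀≗ (eG x)) (∈-image eG x)
    soleᴳ′ : ∀ w → image eG w ≡ g p c₀ (eG x) → g p c₁ w ≡ g p c₁ (eG x) → w ≡ eG x
    soleᴳ′ w w∈ w₁ with ∈-image⁻ eG (trans w∈ x∈)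
    ... | i , refl = cong eG (separates i x w₁)
    soleᴴ′ : ∀ w → image eH w ≡ g p c₀ (eG x) → h p c₁ w ≡ g p c₁ (eG x) → w ≡ eH x
    soleᴴ′ w w∈ w₁ with ∈-image⁻ eH (trans w∈ x∈)
    ... | i , refl = cong eH (separates i x (trans (sym (eH∼eG i c₁)) w₁))

  -- Were there a second vertex v with the colours 0 and 2 of v₀, ∀ would colour {v₀} by 1;
  -- u₀, the only possible realiser of both palettes in G, would need colour 1 both on and off.
  assume-uniqueᴴ : ∀ {p} u₀ v₀ →
    (∀ u → g p c₀ u ≡ h p c₀ v₀ → g p c₂ u ≡ h p c₂ v₀ → u ≡ u₀) →
    ((∀ v → h p c₀ v ≡ h p c₀ v₀ → h p c₂ v ≡ h p c₂ v₀ → v ≡ v₀) → ForallForcesWin p) →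
    ForallForcesWin p
  assume-uniqueᴴ {p} u₀ v₀ unique-u₀ = assume-each only-v₀
    where
    open ≡-Reasoning
    split : ∀ v → v ≢ v₀ → h p c₀ v ≡ h p c₀ v₀ → h p c₂ v ≡ h p c₂ v₀ → ForallForcesWin p
    split v v≢v₀ v₀∼ v₂∼ =
      playH c₁ ｛ v₀ ｝ λ X →
      realisedInᴳ v₀ λ u u∼v₀ →
      realisedInᴳ v λ u' u'∼v →
      let u≡u₀  = unique-u₀ u (u∼v₀ c₀) (u∼v₀ c₂)
          u'≡u₀ = unique-u₀ u' (trans (u'∼v c₀) v₀∼) (trans (u'∼v c₂) v₂∼)
      in ⊥-elim (true≢false (begin
        true       ≡⟨ dec-true (v₀ ≟ v₀) refl ⟨
        ｛ v₀ ｝ v₀ ≡⟨ u∼v₀ c₁ ⟨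
        X u        ≡⟨ cong X (trans u≡u₀ (sym u'≡u₀)) ⟩
        X u'       ≡⟨ u'∼v c₁ ⟩
        ｛ v₀ ｝ v  ≡⟨ dec-false (v ≟ v₀) v≢v₀ ⟩
        false      ∎))
    only-v₀ : ∀ v → ((h p c₀ v ≡ h p c₀ v₀ → h p c₂ v ≡ h p c₂ v₀ → v ≡ v₀) → ForallForcesWin p) →
              ForallForcesWin p
    only-v₀ v k with v ≟ v₀ | h p c₀ v ≟ᵇ h p c₀ v₀ | h p c₂ v ≟ᵇ h p c₂ v₀
    ... | yes v≡v₀ | _        | _        = k λ _ _ → v≡v₀
    ... | no v≢v₀  | yes v₀∼  | yes v₂∼  = split v v≢v₀ v₀∼ v₂∼
    ... | no _     | no v₀≁   | _        = k λ v₀∼ _ → ⊥-elim (v₀≁ v₀∼)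
    ... | no _     | yes _    | no v₂≁   = k λ _ v₂∼ → ⊥-elim (v₂≁ v₂∼)

  -- Colour 2 goes to R ∖ u₀; the unique vertex v₀ of R' that ∃ leaves out must share the palette
  -- of u₀, in particular its colour 1.  Colour 0 then takes over R ∖ u₀ and colours 1, 2 are freed.
  delete-stepᴳ : ∀ {R A R' B} u₀ → R u₀ ≡ true →
    (∀ v₀ → R' v₀ ≡ true → A u₀ ≡ B v₀ → ForallForcesWin (marked (R ∖ u₀) (R' ∖ v₀))) →
    ForallForcesWin ⟪ R , A , ∅ ∣ R' , B , ∅ ⟫
  delete-stepᴳ {R} u₀ u₀∈R k =
    playG c₂ (R ∖ u₀) λ Z →
    assumeᴴ (λ a _ c → c ≡ true → a ≡ true) (∖-⊆ R u₀) λ Z⊆R' →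
    realisedInᴴ u₀ λ v₀ v₀∼u₀ →
    let v₀∈R' = trans (v₀∼u₀ c₀) u₀∈R
        v₀∉Z  = trans (v₀∼u₀ c₂) (∖-removes R u₀)
    in
    playG c₁ ∅ λ Y →
    assumeᴴ (λ _ b _ → b ≡ false) (λ _ → refl) λ Y≗∅ →
    assume-uniqueᴴ u₀ v₀ (λ u u∈R u∉Z → ∖-only {S = R} (trans u∈R v₀∈R') (trans u∉Z v₀∉Z))
      λ only-v₀ →
    let Z≗R'∖v₀ = ≗-∖ Z⊆R' v₀∉Z λ v v∈R' v∉Z →
                    only-v₀ v (trans v∈R' (sym v₀∈R')) (trans v∉Z (sym v₀∉Z))
    in
    playG c₀ (R ∖ u₀) λ Q →
    assumeᴴ (λ a _ c → a ≡ c) (λ _ → refl) λ Q≗Z →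
    playG c₂ ∅ λ Z' →
    assumeᴴ (λ _ _ c → c ≡ false) (λ _ → refl) λ Z'≗∅ →
    forcesWin-resp
      ( by-colour ≗-refl ≗-refl ≗-refl
      , ≋-sym (by-colour (λ v → trans (Q≗Z v) (Z≗R'∖v₀ v)) Y≗∅ Z'≗∅))
      (k v₀ v₀∈R' (sym (v₀∼u₀ c₁)))

  restrict-to-c₁ : ∀ {R X R' Y} → ForallForcesWin (marked (R ∩ X) (R' ∩ Y)) →
                   ForallForcesWin ⟪ R , X , ∅ ∣ R' , Y , ∅ ⟫
  restrict-to-c₁ {R} {X} k =
    playG c₂ (R ∩ X) λ Z →
    assumeᴴ (λ a b c → c ≡ a ∧ b) (λ _ → refl) λ Z≗R'∩Y →
    playG c₀ (R ∩ X) λ Q →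
    assumeᴴ (λ a _ c → a ≡ c) (λ _ → refl) λ Q≗Z →
    playG c₁ ∅ λ Y' →
    assumeᴴ (λ _ b _ → b ≡ false) (λ _ → refl) λ Y'≗∅ →
    playG c₂ ∅ λ Z' →
    assumeᴴ (λ _ _ c → c ≡ false) (λ _ → refl) λ Z'≗∅ →
    forcesWin-resp
      ( by-colour ≗-refl ≗-refl ≗-refl
      , ≋-sym (by-colour (λ v → trans (Q≗Z v) (Z≗R'∩Y v)) Y'≗∅ Z'≗∅))
      k

  wins-on-different-sizes : (a : Fin k → Fin (size G)) (b : Fin m → Fin (size H)) →
    Injective _≡_ _≡_ a → Injective _≡_ _≡_ b → k ≢ m →
    ForallForcesWin (marked (image a) (image b))
  wins-on-different-sizes {zero} {zero} _ _ _ _ k≢m = ⊥-elim (k≢m refl)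
  wins-on-different-sizes {zero} {suc _} a b _ _ _ =
    realisedInᴳ (b zero) λ u u∼b₀ →
    case ∈-image⁻ a {u} (trans (u∼b₀ c₀) (∈-image b zero)) of λ ()
  wins-on-different-sizes {suc _} {zero} a b _ _ _ =
    realisedInᴴ (a zero) λ v v∼a₀ →
    case ∈-image⁻ b {v} (trans (v∼a₀ c₀) (∈-image a zero)) of λ ()
  wins-on-different-sizes {suc _} {suc _} a b a-inj b-inj k≢m =
    delete-stepᴳ (a zero) (∈-image a zero) λ v₀ v₀∈ _ → delete-from-b (∈-image⁻ b v₀∈)
    where
    delete-from-b : ∀ {v₀} → ∃ (λ j → b j ≡ v₀) →
                    ForallForcesWin (marked (image a ∖ a zero) (image b ∖ v₀))
    delete-from-b (j , refl) = marked-resp (image-∖ a-inj zero) (image-∖ b-inj j)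
      (wins-on-different-sizes (a ∘ punchIn zero) (b ∘ punchIn j)
        (∘-punchIn-injective a-inj zero) (∘-punchIn-injective b-inj j) (k≢m ∘ cong suc))

  WinsOnRegions : ℕ → ℕ → Set
  WinsOnRegions n n' = (eG : Fin n → Fin (size G)) (eH : Fin n' → Fin (size H)) →
    Injective _≡_ _≡_ eG → Injective _≡_ _≡_ eH → ¬ (induced G eG ≅ induced H eH) →
    ForallForcesWin (marked (image eG) (image eH))

  wins-on-one-vertex : WinsOnRegions 1 1
  wins-on-one-vertex eG eH _ _ = wins-on-twinned eG eH
    (twins-separated-by-c₁ eG eH ≗-refl ≗-refl (λ { zero → matched }) λ { zero zero _ → refl })
    where
    p : Position
    p = marked (image eG) (image eH)
    matched : ∀ c → h p c (eH zero) ≡ g p c (eG zero)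
    matched zero             = trans (∈-image eH zero) (sym (∈-image eG zero))
    matched (suc zero)       = refl
    matched (suc (suc zero)) = refl

  wins-on-two-vertices : WinsOnRegions 2 2
  wins-on-two-vertices eG eH eG-inj _ G≇H = play₁ ｛ eG zero ｝ λ Y → by-answer Y
    where
    q : (Fin (size H) → Bool) → Position
    q Y = ⟪ image eG , ｛ eG zero ｝ , ∅ ∣ image eH , Y , ∅ ⟫

    aligned-by : ∀ {Y} (τ : Fin 2 ↔ Fin 2) → (∀ x → Y (eH (Inverse.to τ x)) ≡ ｛ zero ｝ x) →
                 ForallForcesWin (q Y)
    aligned-by {Y} τ Y∘τ = wins-on-twinned eG (eH ∘ to)
      (twins-separated-by-c₁ eG (eH ∘ to) ≗-refl (sym ∘ image-∘-↔ {e = eH} τ) matched separates)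
      (G≇H ∘ λ φ → ≅-trans {induced G eG} {induced H (eH ∘ to)} {induced H eH}
                           φ (induced-reindex H {eH} τ))
      where
      open Inverse τ
      matched : ∀ x c → h (q Y) c (eH (to x)) ≡ g (q Y) c (eG x)
      matched x zero             = trans (∈-image eH (to x)) (sym (∈-image eG x))
      matched x (suc zero)       = trans (Y∘τ x) (sym (｛｝-∘ eG-inj zero x))
      matched x (suc (suc zero)) = refl
      separates : ∀ i x → ｛ eG zero ｝ (eG i) ≡ ｛ eG zero ｝ (eG x) → i ≡ x
      separates i x eq = ｛zero｝-injective
        (trans (sym (｛｝-∘ eG-inj zero i)) (trans eq (｛｝-∘ eG-inj zero x)))

    constant-answer-loses : ∀ {Y} i → (∀ j → Y (eH j) ≡ not (｛ zero ｝ i)) → ForallForcesWin (q Y)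
    constant-answer-loses {Y} i Y≡ = realisedInᴴ (eG i) λ v v∼eGᵢ →
      case ∈-image⁻ eH {v} (trans (v∼eGᵢ c₀) (∈-image eG i)) of λ where
        (j , refl) → ⊥-elim (not-¬ (trans (v∼eGᵢ c₁) (｛｝-∘ eG-inj zero i)) (Y≡ j))

    by-answer : ∀ Y → ForallForcesWin (q Y)
    by-answer Y with Y (eH zero) in Y₀ | Y (eH (suc zero)) in Y₁
    ... | true  | false = aligned-by (↔-id _) λ { zero → Y₀ ; (suc zero) → Y₁ }
    ... | false | true  = aligned-by (transpose zero (suc zero)) λ { zero → Y₁ ; (suc zero) → Y₀ }
    ... | true  | true  = constant-answer-loses (suc zero) λ { zero → Y₀ ; (suc zero) → Y₁ }
    ... | false | false = constant-answer-loses zero λ { zero → Y₀ ; (suc zero) → Y₁ }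

module Strategy (rc : ReconstructionConjecture) (G H : Graph) where
  open Game G H public
  private module Mirror = Game H G

  delete-stepᴴ : ∀ {R A R' B} v₀ → R' v₀ ≡ true →
    (∀ u₀ → R u₀ ≡ true → A u₀ ≡ B v₀ → ForallForcesWin (marked (R ∖ u₀) (R' ∖ v₀))) →
    ForallForcesWin ⟪ R , A , ∅ ∣ R' , B , ∅ ⟫
  delete-stepᴴ v₀ v₀∈R' k = forcesWin-swap (Mirror.delete-stepᴳ v₀ v₀∈R' λ u₀ u₀∈R B≡A →
    Mirror.forcesWin-swap (k u₀ u₀∈R (sym B≡A)))

  reconstruction-step : WinsOnRegions (suc (suc m)) (suc (suc m)) →
                        WinsOnRegions (suc (suc (suc m))) (suc (suc (suc m)))
  reconstruction-step IH eG eH eG-inj eH-inj G≇H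
    with rc (induced G eG) (induced H eH) G≇H (inj₁ (s≤s (s≤s (s≤s z≤n))))
  ... | F , k , l , k≢l , (fK , fK-inj , K-deck) , (fL , fL-inj , L-deck) =
    play₁ (image (eG ∘ fK)) λ Y →
    assume-each (agree-or-delete Y) λ agree →
    restrict-to-c₁ (marked-resp (image-∩ fK eG-inj (image-∘ fK eG-inj)) (image-∩ fL eH-inj agree)
      (wins-on-different-sizes (eG ∘ fK) (eH ∘ fL)
        (injective _≡_ _≡_ _≡_ fK-inj eG-inj) (injective _≡_ _≡_ _≡_ fL-inj eH-inj) k≢l))
    where
    q : (Fin (size H) → Bool) → Position
    q Y = ⟪ image eG , image (eG ∘ fK) , ∅ ∣ image eH , Y , ∅ ⟫

    agree-or-delete : ∀ Y j → (Y (eH j) ≡ image fL j → ForallForcesWin (q Y)) →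
                      ForallForcesWin (q Y)
    agree-or-delete Y j k with Y (eH j) ≟ᵇ image fL j
    ... | yes agrees = k agrees
    ... | no differs =
      delete-stepᴴ (eH j) (∈-image eH j) λ u₀ u₀∈R A≡Y → recurse (∈-image⁻ eG u₀∈R) A≡Y
      where
      recurse : ∀ {u₀} → ∃ (λ i → eG i ≡ u₀) → image (eG ∘ fK) u₀ ≡ Y (eH j) →
                ForallForcesWin (marked (image eG ∖ u₀) (image eH ∖ eH j))
      recurse (i , refl) A≡Y = marked-resp (image-∖ eG-inj i) (image-∖ eH-inj j)
        (IH (eG ∘ punchIn i) (eH ∘ punchIn j)
          (∘-punchIn-injective eG-inj i) (∘-punchIn-injective eH-inj j) cards-differ)
        where
        open ≡-Reasoning
        cards-differ : ¬ (delete (induced G eG) i ≅ delete (induced H eH) j)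
        cards-differ φ = differs (begin
          Y (eH j)               ≡⟨ A≡Y ⟨
          image (eG ∘ fK) (eG i) ≡⟨ image-∘ fK eG-inj i ⟩
          image fK i             ≡⟨ iso-cards-agree {K = induced G eG} {induced H eH} {F}
                                      K-deck L-deck φ ⟩
          image fL j             ∎)

  wins-on-equal-sizes : ∀ n → WinsOnRegions n n
  wins-on-equal-sizes zero eG eH _ _      = wins-on-twinned eG eH λ ()
  wins-on-equal-sizes (suc zero)          = wins-on-one-vertex
  wins-on-equal-sizes (suc (suc zero))    = wins-on-two-vertices
  wins-on-equal-sizes (suc (suc (suc m))) = reconstruction-step (wins-on-equal-sizes (suc (suc m)))

  wins-on-regions : ∀ {n n'} → WinsOnRegions n n'
  wins-on-regions {n} {n'} eG eH eG-inj eH-inj G≇H with n ≟ℕ n'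
  ... | yes refl = wins-on-equal-sizes n eG eH eG-inj eH-inj G≇H
  ... | no n≢n'  = wins-on-different-sizes eG eH eG-inj eH-inj n≢n'

theorem8p3 : ReconstructionConjecture →
    ∀ (G H : Graph) → ¬ (G ≅ H) → ForallHasWinningStrategy 3 G H
theorem8p3 rc G H G≇H =
  playG c₀ (λ _ → true) λ T →
  assumeᴴ (λ a _ _ → a ≡ true) (λ _ → refl) λ T-full →
  forcesWin-resp
    ( by-colour (∈-image id) ≗-refl ≗-refl
    , by-colour (λ v → trans (∈-image id v) (sym (T-full v))) ≗-refl ≗-refl)
    (wins-on-regions id id id id G≇H)
  where open Strategy rc G H
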